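{- Let $P \in \mathbb{Z}[x]$ and let $p$ be a prime. Then there exist polynomials $P_+, P_- \in \mathbb{Z}[x]$ such that: for every prime $q \neq p$, either $q$ lies in all of $S(P), S(P_+), S(P_-)$ or in none of them; $p \in S(P_+)$; and $p \notin S(P_-)$.
   Context: For $P \in \mathbb{Z}[x]$, $S(P)$ denotes the set of primes $q$ such that $q \mid P(k)$ for some integer $k$. -}

module Defs where

open import Data.Nat using (ℕ)
open import Data.Integer using (ℤ; +_; _+_; _*_; 0ℤ)
open import Data.Integer.Divisibility using (_∣_)
open import Data.List using (List; []; _∷_)
open import Data.Product using (∃)

-- A polynomial in ℤ[x] is represented by its list of coefficients,
-- lowest degree first: a₀ ∷ a₁ ∷ … ∷ aₙ ∷ [] denotes a₀ + a₁ x + … + aₙ xⁿ.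
-- (Trailing zeros are allowed; they do not change the evaluation map.)
Poly : Set
Poly = List ℤ

eval : Poly → ℤ → ℤ
eval []       k = 0ℤ
eval (a ∷ as) k = a + k * eval as k

InS : ℕ → Poly → Set
InS q P = ∃ λ (k : ℤ) → (+ q) ∣ eval P k

-- Put P₊ = p·P. For P₋, write the constant term of P as a = pᵉb with p ∤ b and take
-- P₋(x) = P(p^(e+1) x) / pᵉ = b + p·(…), so P₋(x) ≡ b ≢ 0 (mod p). A relation
-- c·Q(x) = R(m x) forces S(Q) and S(R) to agree at every prime q ∤ cm: q ∣ Q(x) gives
-- q ∣ R(mx), and q ∣ R(k) gives q ∣ Q(x) for the solution x of m x ≡ k (mod q).
-- This applies to (Q, R) = (P, P₊) and (P₋, P). If a = 0, S(P) contains every prime,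
-- as does S(1 + x), so one may replace P by 1 + x.
module Submission where

open import Defs
open import Data.Nat as ℕ using (ℕ; zero; suc; _^_)
import Data.Nat.Properties as ℕ
import Data.Nat.Divisibility as ℕ
open import Data.Nat.Divisibility using (_∤_)
open import Data.Nat.Induction using (<-wellFounded)
open import Data.Nat.Primality using (Prime; euclidsLemma; prime⇒irreducible; prime⇒nonTrivial; prime⇒nonZero)
open import Data.Nat.Coprimality using (Coprime; coprime-Bézout)
open import Data.Nat.GCD using (module Bézout)
open import Data.Integer as ℤ using (ℤ; +_; _+_; _*_; _-_; -_; 0ℤ; 1ℤ; -1ℤ; ∣_∣)
import Data.Integer.Properties as ℤ
open import Data.Integer.DivMod using (_%ℕ_; _/ℕ_; n%ℕd<d; a≡a%ℕn+[a/ℕn]*n)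
open import Data.Integer.Divisibility.Signed
open import Data.Integer.Tactic.RingSolver using (solve-∀)
open import Data.Fin using (toℕ; fromℕ<)
open import Data.Fin.Properties using (any?; toℕ-fromℕ<)
open import Data.List using ([]; _∷_; map)
open import Data.Product using (Σ; ∃; ∃₂; _×_; _,_)
open import Data.Sum using (_⊎_; inj₁; inj₂)
open import Function.Base using (_∘_; _$_)
open import Function.Bundles using (_⇔_; mk⇔; Equivalence)
open import Function.Construct.Composition using (_⇔-∘_)
open import Function.Construct.Symmetry using (⇔-sym)
open import Induction.WellFounded using (Acc; acc)
open import Relation.Binary.Construct.On using () renaming (wellFounded to wellFounded-on)
open import Relation.Nullary using (¬_; Dec; yes; no; contradiction)
open import Relation.Binary.PropositionalEquality
open ≡-Reasoning

prime∤prime : ∀ {q p} → Prime q → Prime p → q ≢ p → q ∤ p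
prime∤prime q-prime p-prime q≢p q∣p with prime⇒irreducible p-prime q∣p
... | inj₁ q≡1 = ℕ.nonTrivial⇒≢1 {{prime⇒nonTrivial q-prime}} q≡1
... | inj₂ q≡p = q≢p q≡p

prime∤1 : ∀ {q} → Prime q → q ∤ 1
prime∤1 q-prime q∣1 = ℕ.nonTrivial⇒≢1 {{prime⇒nonTrivial q-prime}} (ℕ.∣1⇒≡1 q∣1)

prime∤^ : ∀ {q n} → Prime q → q ∤ n → ∀ e → q ∤ n ^ e
prime∤^ q-prime q∤n zero = prime∤1 q-prime
prime∤^ {n = n} q-prime q∤n (suc e) q∣nⁿ with euclidsLemma n (n ^ e) q-prime q∣nⁿ
... | inj₁ q∣n  = q∤n q∣n
... | inj₂ q∣nᵉ = prime∤^ q-prime q∤n e q∣nᵉ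

prime∤⇒coprime : ∀ {q n} → Prime q → q ∤ n → Coprime q n
prime∤⇒coprime q-prime q∤n (d∣q , d∣n) with prime⇒irreducible q-prime d∣q
... | inj₁ d≡1 = d≡1
... | inj₂ refl = contradiction d∣n q∤n

euclidsLemmaℤ : ∀ {q} → Prime q → ∀ i j → (+ q) ∣ i * j → ((+ q) ∣ i) ⊎ ((+ q) ∣ j)
euclidsLemmaℤ {q} q-prime i j q∣ij
  with euclidsLemma ∣ i ∣ ∣ j ∣ q-prime (subst (q ℕ.∣_) (ℤ.abs-* i j) (∣⇒∣ᵤ q∣ij))
... | inj₁ q∣i = inj₁ (∣ᵤ⇒∣ q∣i)
... | inj₂ q∣j = inj₂ (∣ᵤ⇒∣ q∣j)

∣m-n∣n⇒∣m : ∀ {i m n} → i ∣ m - n → i ∣ n → i ∣ m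
∣m-n∣n⇒∣m {i} {m} {n} i∣m-n i∣n =
  subst (i ∣_) (m-n+n≡m m n) (∣m∣n⇒∣m+n i∣m-n i∣n)
  where
  m-n+n≡m : ∀ m n → m - n + n ≡ m
  m-n+n≡m = solve-∀

∃-inverse-mod : ∀ {q m} → Coprime q m → ∃ λ u → (+ q) ∣ u * + m - 1ℤ
∃-inverse-mod {q} {m} q⊥m with coprime-Bézout q⊥m
... | Bézout.+- x y 1+ym≡xq = - + y , divides (- + x) (begin
  - + y * + m - 1ℤ     ≡⟨ rearrange (+ y) (+ m) ⟩
  - (1ℤ + + y * + m)   ≡⟨ cong -_ cast ⟩
  - (+ x * + q)        ≡⟨ ℤ.neg-distribˡ-* (+ x) (+ q) ⟩
  - + x * + q          ∎)
  where
  rearrange : ∀ y m → - y * m - 1ℤ ≡ - (1ℤ + y * m)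
  rearrange = solve-∀
  cast : 1ℤ + + y * + m ≡ + x * + q
  cast = begin
    1ℤ + + y * + m     ≡⟨ cong (λ t → 1ℤ + t) (ℤ.pos-* y m) ⟨
    + (1 ℕ.+ y ℕ.* m)  ≡⟨ cong +_ 1+ym≡xq ⟩
    + (x ℕ.* q)        ≡⟨ ℤ.pos-* x q ⟩
    + x * + q          ∎
... | Bézout.-+ x y 1+xq≡ym = + y , divides (+ x) (begin
  + y * + m - 1ℤ              ≡⟨ cong (_- 1ℤ) (ℤ.pos-* y m) ⟨
  + (y ℕ.* m) - 1ℤ            ≡⟨ cong (λ t → + t - 1ℤ) 1+xq≡ym ⟨
  + (1 ℕ.+ x ℕ.* q) - 1ℤ      ≡⟨ cong (λ t → 1ℤ + t - 1ℤ) (ℤ.pos-* x q) ⟩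
  1ℤ + + x * + q - 1ℤ         ≡⟨ cancel (+ x * + q) ⟩
  + x * + q                   ∎)
  where
  cancel : ∀ t → 1ℤ + t - 1ℤ ≡ t
  cancel = solve-∀

∃-solution-mod : ∀ {q m} → Coprime q m → ∀ k → ∃ λ x → (+ q) ∣ + m * x - k
∃-solution-mod {q} {m} q⊥m k with u , q∣um-1 ← ∃-inverse-mod q⊥m =
  u * k , subst ((+ q) ∣_) (expand (+ m) u k) (∣n⇒∣m*n k q∣um-1)
  where
  expand : ∀ m u k → k * (u * m - 1ℤ) ≡ m * (u * k) - k
  expand = solve-∀

scale : ℤ → Poly → Poly
scale c = map (c *_)

dilate : ℤ → Poly → Poly
dilate m []       = []
dilate m (a ∷ as) = a ∷ scale m (dilate m as)

eval-scale : ∀ c P x → eval (scale c P) x ≡ c * eval P x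
eval-scale c []       x = sym (ℤ.*-zeroʳ c)
eval-scale c (a ∷ as) x = begin
  c * a + x * eval (scale c as) x  ≡⟨ cong (λ t → c * a + x * t) (eval-scale c as x) ⟩
  c * a + x * (c * eval as x)      ≡⟨ distribute c a x (eval as x) ⟩
  c * (a + x * eval as x)          ∎
  where
  distribute : ∀ c a x t → c * a + x * (c * t) ≡ c * (a + x * t)
  distribute = solve-∀

eval-dilate : ∀ m P x → eval (dilate m P) x ≡ eval P (m * x)
eval-dilate m []       x = refl
eval-dilate m (a ∷ as) x = begin
  a + x * eval (scale m (dilate m as)) x  ≡⟨ cong (λ t → a + x * t) (eval-scale m (dilate m as) x) ⟩
  a + x * (m * eval (dilate m as) x)      ≡⟨ cong (λ t → a + x * (m * t)) (eval-dilate m as x) ⟩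
  a + x * (m * eval as (m * x))           ≡⟨ reassociate a x m (eval as (m * x)) ⟩
  a + m * x * eval as (m * x)             ∎
  where
  reassociate : ∀ a x m t → a + x * (m * t) ≡ a + m * x * t
  reassociate = solve-∀

eval-cong-mod : ∀ {d} P {u v} → d ∣ u - v → d ∣ eval P u - eval P v
eval-cong-mod         []       d∣u-v = divides 0ℤ refl
eval-cong-mod {d} (a ∷ as) {u} {v} d∣u-v =
  subst (d ∣_) (sym (split a u v (eval as u) (eval as v)))
    (∣m∣n⇒∣m+n (∣m⇒∣m*n (eval as u) d∣u-v) (∣n⇒∣m*n v (eval-cong-mod as d∣u-v)))
  where
  split : ∀ a u v A B → a + u * A - (a + v * B) ≡ (u - v) * A + v * (A - B)
  split = solve-∀

InS-root : ∀ {q} P {k} → eval P k ≡ 0ℤ → InS q P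
InS-root {q} P {k} Pk≡0 = k , ∣⇒∣ᵤ (subst ((+ q) ∣_) (sym Pk≡0) (divides 0ℤ refl))

-- A root of P mod q can be moved to its residue in [0, q), so a finite search decides InS.
InS? : ∀ q .{{_ : ℕ.NonZero q}} P → Dec (InS q P)
InS? q P with any? {n = q} (λ i → q ℕ.∣? ∣ eval P (+ toℕ i) ∣)
... | yes (i , q∣Pi) = yes (+ toℕ i , q∣Pi)
... | no  ¬root      = no λ (k , q∣Pk) → ¬root (fromℕ< (n%ℕd<d k q) , residue-root k (∣ᵤ⇒∣ q∣Pk))
  where
  q∣residue-k : ∀ k → (+ q) ∣ + (k %ℕ q) - k
  q∣residue-k k = divides (- (k /ℕ q)) (begin
    + (k %ℕ q) - k                              ≡⟨ cong (λ t → + (k %ℕ q) - t) (a≡a%ℕn+[a/ℕn]*n k q) ⟩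
    + (k %ℕ q) - (+ (k %ℕ q) + (k /ℕ q) * + q)  ≡⟨ cancel (+ (k %ℕ q)) (k /ℕ q) (+ q) ⟩
    - (k /ℕ q) * + q                            ∎)
    where
    cancel : ∀ r t q → r - (r + t * q) ≡ - t * q
    cancel = solve-∀
  residue-root : ∀ k → (+ q) ∣ eval P k → q ℕ.∣ ∣ eval P (+ toℕ (fromℕ< (n%ℕd<d k q))) ∣
  residue-root k q∣Pk rewrite toℕ-fromℕ< (n%ℕd<d k q) =
    ∣⇒∣ᵤ (∣m-n∣n⇒∣m {m = eval P (+ (k %ℕ q))} (eval-cong-mod P {+ (k %ℕ q)} {k} (q∣residue-k k)) q∣Pk)

module _ {n : ℕ} (1<n : 1 ℕ.< n) where

  private
    _≺_ : ℤ → ℤ → Set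
    i ≺ j = ∣ i ∣ ℕ.< ∣ j ∣

    cofactor-smaller : ∀ {a t} → a ≡ t * + n → a ≢ 0ℤ → t ≢ 0ℤ × t ≺ a
    cofactor-smaller {a} {t} a≡tn a≢0 = t≢0 ,
      subst (∣ t ∣ ℕ.<_) (trans (sym (ℤ.abs-* t (+ n))) (cong ∣_∣ (sym a≡tn)))
        (ℕ.m<m*n ∣ t ∣ n {{ℕ.≢-nonZero (t≢0 ∘ ℤ.∣i∣≡0⇒i≡0)}} 1<n)
      where
      t≢0 : t ≢ 0ℤ
      t≢0 refl = a≢0 a≡tn

  factor-powers : ∀ a → a ≢ 0ℤ → ∃₂ λ e b → a ≡ + (n ^ e) * b × ¬ (+ n) ∣ b
  factor-powers a = go a (wellFounded-on ∣_∣ <-wellFounded a)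
    where
    go : ∀ a → Acc _≺_ a → a ≢ 0ℤ → ∃₂ λ e b → a ≡ + (n ^ e) * b × ¬ (+ n) ∣ b
    go a (acc smaller) a≢0 with (+ n) ∣? a
    ... | no n∤a = 0 , a , sym (ℤ.*-identityˡ a) , n∤a
    ... | yes (divides t a≡tn) with t≢0 , t≺a ← cofactor-smaller a≡tn a≢0
                               with e , b , t≡nᵉb , n∤b ← go t (smaller t≺a) t≢0 =
      suc e , b , (begin
        a                        ≡⟨ a≡tn ⟩
        t * + n                  ≡⟨ cong (_* + n) t≡nᵉb ⟩
        + (n ^ e) * b * + n      ≡⟨ rotate (+ (n ^ e)) b (+ n) ⟩
        + n * + (n ^ e) * b      ≡⟨ cong (_* b) (ℤ.pos-* n (n ^ e)) ⟨
        + (n ^ suc e) * b        ∎) , n∤b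
      where
      rotate : ∀ x b y → x * b * y ≡ y * x * b
      rotate = solve-∀

InS-⇔-dilation : ∀ {q c m} P Q → Prime q → q ∤ c → q ∤ m →
                 (∀ x → + c * eval Q x ≡ eval P (+ m * x)) → InS q P ⇔ InS q Q
InS-⇔-dilation {q} {c} {m} P Q q-prime q∤c q∤m cQ≡P∘m = mk⇔ to from
  where
  from : InS q Q → InS q P
  from (x , q∣Qx) = + m * x , ∣⇒∣ᵤ (subst ((+ q) ∣_) (cQ≡P∘m x) (∣n⇒∣m*n (+ c) (∣ᵤ⇒∣ q∣Qx)))

  root-at-solution : ∀ {k} → (+ q) ∣ eval P k → (∃ λ x → (+ q) ∣ + m * x - k) → InS q Q
  root-at-solution q∣Pk (x , q∣mx-k)
    with euclidsLemmaℤ q-prime (+ c) (eval Q x)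
           (subst ((+ q) ∣_) (sym (cQ≡P∘m x))
             (∣m-n∣n⇒∣m {m = eval P (+ m * x)} (eval-cong-mod P q∣mx-k) q∣Pk))
  ... | inj₁ q∣c  = contradiction (∣⇒∣ᵤ q∣c) q∤c
  ... | inj₂ q∣Qx = x , ∣⇒∣ᵤ q∣Qx

  to : InS q P → InS q Q
  to (k , q∣Pk) = root-at-solution (∣ᵤ⇒∣ q∣Pk) (∃-solution-mod (prime∤⇒coprime q-prime q∤m) k)

InS-⇔-scale : ∀ {q c} P → Prime q → q ∤ c → InS q P ⇔ InS q (scale (+ c) P)
InS-⇔-scale {c = c} P q-prime q∤c = ⇔-sym $
  InS-⇔-dilation (scale (+ c) P) P q-prime q∤c (prime∤1 q-prime) λ x → begin
    + c * eval P x                  ≡⟨ eval-scale (+ c) P x ⟨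
    eval (scale (+ c) P) x          ≡⟨ cong (eval (scale (+ c) P)) (ℤ.*-identityˡ x) ⟨
    eval (scale (+ c) P) (+ 1 * x)  ∎

¬InS-p∤constant : ∀ {p b} R → ¬ (+ p) ∣ b → ¬ InS p (b ∷ scale (+ p) R)
¬InS-p∤constant {p} {b} R p∤b (x , p∣b+xpR) =
  p∤b (∣m+n∣n⇒∣m (∣ᵤ⇒∣ p∣b+xpR) p∣xpR)
  where
  p∣xpR : (+ p) ∣ x * eval (scale (+ p) R) x
  p∣xpR = ∣n⇒∣m*n x (subst ((+ p) ∣_) (sym (eval-scale (+ p) R x)) (∣m⇒∣m*n (eval R x) ∣-refl))

SameSExcept : ℕ → Poly → Poly → Set
SameSExcept p P Q = ∀ q → Prime q → q ≢ p → InS q P ⇔ InS q Q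

record WithoutPrime (p : ℕ) (P : Poly) : Set where
  field
    poly  : Poly
    sameS : SameSExcept p P poly
    p∉S   : ¬ InS p poly

withoutPrime-factored : ∀ {p} e b as → Prime p → ¬ (+ p) ∣ b → WithoutPrime p (+ (p ^ e) * b ∷ as)
withoutPrime-factored {p} e b as p-prime p∤b = record
  { poly  = Q
  ; sameS = λ q q-prime q≢p → let q∤p = prime∤prime q-prime p-prime q≢p in
      InS-⇔-dilation (+ (p ^ e) * b ∷ as) Q q-prime
        (prime∤^ q-prime q∤p e) (prime∤^ q-prime q∤p (suc e)) pᵉQ≡P∘pᵉ⁺¹
  ; p∉S   = ¬InS-p∤constant (dilate pᵉ⁺¹ as) p∤b
  }
  where
  pᵉ⁺¹ = + (p ^ suc e)
  Q    = b ∷ scale (+ p) (dilate pᵉ⁺¹ as)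

  pᵉQ≡P∘pᵉ⁺¹ : ∀ x → + (p ^ e) * eval Q x ≡ eval (+ (p ^ e) * b ∷ as) (pᵉ⁺¹ * x)
  pᵉQ≡P∘pᵉ⁺¹ x = begin
    + (p ^ e) * (b + x * eval (scale (+ p) (dilate pᵉ⁺¹ as)) x)
      ≡⟨ cong (λ t → + (p ^ e) * (b + x * t))
           (trans (eval-scale (+ p) (dilate pᵉ⁺¹ as) x) (cong (+ p *_) (eval-dilate pᵉ⁺¹ as x))) ⟩
    + (p ^ e) * (b + x * (+ p * eval as (pᵉ⁺¹ * x)))
      ≡⟨ expand (+ (p ^ e)) b x (+ p) (eval as (pᵉ⁺¹ * x)) ⟩
    + (p ^ e) * b + + p * + (p ^ e) * x * eval as (pᵉ⁺¹ * x)
      ≡⟨ cong (λ v → + (p ^ e) * b + v * x * eval as (pᵉ⁺¹ * x)) (ℤ.pos-* p (p ^ e)) ⟨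
    + (p ^ e) * b + pᵉ⁺¹ * x * eval as (pᵉ⁺¹ * x)
      ∎
    where
    expand : ∀ y b x p t → y * (b + x * (p * t)) ≡ y * b + p * y * x * t
    expand = solve-∀

withoutPrime-vanishing : ∀ {p} P → eval P 0ℤ ≡ 0ℤ → Prime p → WithoutPrime p P
withoutPrime-vanishing P P0≡0 p-prime = record
  { poly  = poly
  ; sameS = λ q q-prime q≢p →
      sameS q q-prime q≢p ⇔-∘ mk⇔ (λ _ → InS-root (1ℤ ∷ 1ℤ ∷ []) {k = -1ℤ} refl) (λ _ → InS-root P P0≡0)
  ; p∉S   = p∉S
  }
  where
  open WithoutPrime (withoutPrime-factored 0 1ℤ (1ℤ ∷ []) p-prime (prime∤1 p-prime ∘ ∣⇒∣ᵤ))

withoutPrime : ∀ {p} P → Prime p → WithoutPrime p P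
withoutPrime []       = withoutPrime-vanishing [] refl
withoutPrime {p} (a ∷ as) p-prime with a ℤ.≟ 0ℤ
... | yes refl = withoutPrime-vanishing (0ℤ ∷ as) (ℤ.*-zeroˡ (eval as 0ℤ)) p-prime
... | no  a≢0  = factored (factor-powers (ℕ.nonTrivial⇒n>1 p {{prime⇒nonTrivial p-prime}}) a a≢0)
  where
  factored : (∃₂ λ e b → a ≡ + (p ^ e) * b × ¬ (+ p) ∣ b) → WithoutPrime p (a ∷ as)
  factored (e , b , refl , p∤b) = withoutPrime-factored e b as p-prime p∤b

all-or-none : ∀ {a b c} {A : Set a} {B : Set b} {C : Set c} →
              Dec A → A ⇔ B → A ⇔ C → (A × B × C) ⊎ (¬ A × ¬ B × ¬ C)
all-or-none (yes a) A⇔B A⇔C = inj₁ (a , Equivalence.to A⇔B a , Equivalence.to A⇔C a)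
all-or-none (no ¬a) A⇔B A⇔C = inj₂ (¬a , ¬a ∘ Equivalence.from A⇔B , ¬a ∘ Equivalence.from A⇔C)

lemma8 : (P : Poly) (p : ℕ) → Prime p →
    Σ Poly λ P₊ → Σ Poly λ P₋ →
      ((q : ℕ) → Prime q → q ≢ p →
        (InS q P × InS q P₊ × InS q P₋) ⊎ (¬ InS q P × ¬ InS q P₊ × ¬ InS q P₋))
      × InS p P₊
      × ¬ InS p P₋
lemma8 P p p-prime = scale (+ p) P , poly , agreement , p∈pP , p∉S
  where
  open WithoutPrime (withoutPrime P p-prime)

  agreement : (q : ℕ) → Prime q → q ≢ p →
    (InS q P × InS q (scale (+ p) P) × InS q poly) ⊎ (¬ InS q P × ¬ InS q (scale (+ p) P) × ¬ InS q poly)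
  agreement q q-prime q≢p =
    all-or-none (InS? q {{prime⇒nonZero q-prime}} P)
      (InS-⇔-scale P q-prime (prime∤prime q-prime p-prime q≢p)) (sameS q q-prime q≢p)

  p∈pP : InS p (scale (+ p) P)
  p∈pP = 0ℤ , ∣⇒∣ᵤ (subst ((+ p) ∣_) (sym (eval-scale (+ p) P 0ℤ)) (∣m⇒∣m*n (eval P 0ℤ) ∣-refl))
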